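{- Let $\varphi,\psi$ be formulas interpreted in team semantics (over a finite set $Prop$ of propositional variables). If $\varphi$ is upward closed and $\psi$ is intersection closed, then $\varphi\Uparrow\psi$ is upward closed and intersection closed. In particular, if $\varphi$ and $\psi$ are both upward closed and intersection closed, then so is $\varphi\Uparrow\psi$.
   Context: A valuation is a function $v:Prop\to\{0,1\}$; a team is a set of valuations; $T\models\varphi$ denotes satisfaction. The dual intuitionistic implication $\Uparrow$ is defined by: $T\models\varphi\Uparrow\psi$ iff for all teams $S\supseteq T$, $S\models\varphi$ implies $S\models\psi$. A formula is upward closed if $T\models\varphi$ and $T\subseteq S$ imply $S\models\varphi$; it is intersection closed if $S\models\varphi$ and $T\models\varphi$ imply $S\cap T\models\varphi$. -}

module Defs where

open import Data.Nat using (ℕ)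
open import Data.Fin using (Fin)
open import Data.Bool using (Bool; true; _∧_)
open import Data.Product using (_×_)
open import Relation.Binary.PropositionalEquality using (_≡_; sym; trans)

-- Prop = Fin n (a finite set of n propositional variables).
Valuation : ℕ → Set
Valuation n = Fin n → Bool

-- A team is a set of valuations; since the set of valuations is finite,
-- membership is decidable, so a team is its (Bool-valued) characteristic function.
Team : ℕ → Set
Team n = Valuation n → Bool

_∈ₜ_ : ∀ {n} → Valuation n → Team n → Set
v ∈ₜ T = T v ≡ true

_⊆ₜ_ : ∀ {n} → Team n → Team n → Set
T ⊆ₜ S = ∀ v → v ∈ₜ T → v ∈ₜ S

_≐_ : ∀ {n} → Team n → Team n → Set
S ≐ T = ∀ v → S v ≡ T v

_∩ₜ_ : ∀ {n} → Team n → Team n → Team n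
(S ∩ₜ T) v = S v ∧ T v

-- A formula is given by its team semantics: the property T ↦ (T ⊨ φ).
-- Since teams are sets, satisfaction must respect equality of teams as sets.
record Formula (n : ℕ) : Set₁ where
  field
    _⊨ : Team n → Set
    respects : ∀ {S T} → S ≐ T → _⊨ S → _⊨ T
open Formula public

_⊨_ : ∀ {n} → Team n → Formula n → Set
T ⊨ φ = Formula._⊨ φ T

UpwardClosed : ∀ {n} → Formula n → Set
UpwardClosed φ = ∀ T S → T ⊨ φ → T ⊆ₜ S → S ⊨ φ

IntersectionClosed : ∀ {n} → Formula n → Set
IntersectionClosed φ = ∀ S T → S ⊨ φ → T ⊨ φ → (S ∩ₜ T) ⊨ φ

_⇑_ : ∀ {n} → Formula n → Formula n → Formula n
Formula._⊨ (φ ⇑ ψ) T = ∀ S → T ⊆ₜ S → S ⊨ φ → S ⊨ ψ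
Formula.respects (φ ⇑ ψ) {T} {T'} eq h S T'⊆S Sφ =
  h S (λ v v∈T → T'⊆S v (trans (sym (eq v)) v∈T)) Sφ

{-# OPTIONS --safe #-}
module Submission where

-- Upward closure of φ ⇑ ψ is immediate, since the condition only concerns supersets. For
-- intersection closure, let U ⊇ S ∩ T satisfy φ. By upward closure of φ, the teams
-- U ∪ S ⊇ S and U ∪ T ⊇ T satisfy φ, hence ψ; and their intersection is
-- U ∪ (S ∩ T) = U, which therefore satisfies ψ by intersection closure of ψ.

open import Defs
open import Data.Nat using (ℕ)
open import Data.Product using (_×_; _,_)
open import Data.Bool using (Bool; true; false; _∧_; _∨_)
open import Data.Bool.Properties using (∨-distribˡ-∧)
open import Relation.Binary.PropositionalEquality using (_≡_; refl; sym; trans)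

_∪ₜ_ : ∀ {n} → Team n → Team n → Team n
(S ∪ₜ T) v = S v ∨ T v

⊆ₜ-trans : ∀ {n} {R S T : Team n} → R ⊆ₜ S → S ⊆ₜ T → R ⊆ₜ T
⊆ₜ-trans R⊆S S⊆T v v∈R = S⊆T v (R⊆S v v∈R)

⊆ₜ-∪ˡ : ∀ {n} (S T : Team n) → S ⊆ₜ (S ∪ₜ T)
⊆ₜ-∪ˡ S T v v∈S rewrite v∈S = refl

⊆ₜ-∪ʳ : ∀ {n} (S T : Team n) → T ⊆ₜ (S ∪ₜ T)
⊆ₜ-∪ʳ S T v v∈T with S v
... | true  = refl
... | false = v∈T

∨-absorbs-implied : ∀ {x y : Bool} → (y ≡ true → x ≡ true) → x ∨ y ≡ x
∨-absorbs-implied {true}          y⇒x = refl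
∨-absorbs-implied {false} {true}  y⇒x = sym (y⇒x refl)
∨-absorbs-implied {false} {false} y⇒x = refl

∪ₜ-∩ₜ-absorb : ∀ {n} {S T U : Team n} → (S ∩ₜ T) ⊆ₜ U → ((U ∪ₜ S) ∩ₜ (U ∪ₜ T)) ≐ U
∪ₜ-∩ₜ-absorb {S = S} {T} {U} S∩T⊆U v =
  trans (sym (∨-distribˡ-∧ (U v) (S v) (T v))) (∨-absorbs-implied (S∩T⊆U v))

⇑-upwardClosed : ∀ {n} (φ ψ : Formula n) → UpwardClosed (φ ⇑ ψ)
⇑-upwardClosed φ ψ T S T⇑ T⊆S R S⊆R = T⇑ R (⊆ₜ-trans T⊆S S⊆R)

⇑-intersectionClosed : ∀ {n} (φ ψ : Formula n)
  → UpwardClosed φ → IntersectionClosed ψ → IntersectionClosed (φ ⇑ ψ)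
⇑-intersectionClosed φ ψ upφ ∩ψ S T S⇑ T⇑ U S∩T⊆U Uφ =
  respects ψ (∪ₜ-∩ₜ-absorb S∩T⊆U) (∩ψ (U ∪ₜ S) (U ∪ₜ T) (extend S S⇑) (extend T T⇑))
  where
  extend : ∀ R → R ⊨ (φ ⇑ ψ) → (U ∪ₜ R) ⊨ ψ
  extend R R⇑ = R⇑ (U ∪ₜ R) (⊆ₜ-∪ʳ U R) (upφ U (U ∪ₜ R) Uφ (⊆ₜ-∪ˡ U R))

proposition2 : ∀ {n : ℕ} (φ ψ : Formula n)
    → UpwardClosed φ → IntersectionClosed ψ
    → UpwardClosed (φ ⇑ ψ) × IntersectionClosed (φ ⇑ ψ)
proposition2 φ ψ upφ ∩ψ = ⇑-upwardClosed φ ψ , ⇑-intersectionClosed φ ψ upφ ∩ψ
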